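{- Let $\mathcal{H}$ be an ABA-free hypergraph on a finite totally ordered vertex set $V$ with $|V|=n\ge 2$ such that for every pair of vertices of $V$ there is a hyperedge of $\mathcal{H}$ containing both of them. Then there exist at most two hyperedges of $\mathcal{H}$ whose union is $V$.
   Context: A hypergraph $\mathcal{F}$ on a totally ordered finite vertex set $V$ (i.e., a family of subsets of $V$) is called ABA-free if there are no two hyperedges $A,B\in\mathcal{F}$ and three vertices $x<y<z$ such that $x,z\in A\setminus B$ and $y\in B\setminus A$. -}

module Defs where

open import Data.Nat using (ℕ)
open import Data.Fin using (Fin; _<_)
open import Data.Fin.Subset using (Subset) renaming (_∈_ to _∈ₛ_; _∉_ to _∉ₛ_)
open import Data.List using (List)
open import Data.List.Membership.Propositional using (_∈_)
open import Data.Product using (_×_; ∃-syntax)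
open import Data.Sum using (_⊎_)
open import Relation.Nullary using (¬_)
open import Relation.Binary.PropositionalEquality using (_≢_)

-- A hypergraph on the totally ordered vertex set Fin n (natural order):
-- a finite family (list) of subsets of Fin n.
Hypergraph : ℕ → Set
Hypergraph n = List (Subset n)

ABA-free : ∀ {n} → Hypergraph n → Set
ABA-free {n} ℱ =
  ¬ (∃[ A ] ∃[ B ] ∃[ x ] ∃[ y ] ∃[ z ]
       (A ∈ ℱ × B ∈ ℱ × x < y × y < z
        × x ∈ₛ A × x ∉ₛ B × z ∈ₛ A × z ∉ₛ B
        × y ∈ₛ B × y ∉ₛ A))

PairCovering : ∀ {n} → Hypergraph n → Set
PairCovering {n} ℱ =
  (x y : Fin n) → x ≢ y → ∃[ A ] (A ∈ ℱ × x ∈ₛ A × y ∈ₛ A)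

-- V is the union of at most two hyperedges (A = B allowed).
CoveredByTwo : ∀ {n} → Hypergraph n → Set
CoveredByTwo {n} ℱ =
  ∃[ A ] ∃[ B ] (A ∈ ℱ × B ∈ ℱ × ((v : Fin n) → v ∈ₛ A ⊎ v ∈ₛ B))

{-# OPTIONS --safe #-}
module Submission where

-- For every vertex v of an interval [a, b] of positions, some hyperedge contains
-- [a, v] or some hyperedge contains [v, b]; this is proved by induction on b − a.
-- In the inductive step the two shorter intervals give hyperedges E ⊇ [v, b) and
-- F ⊇ (a, v], and pair covering gives a hyperedge G ∋ a, b. Unless one of E, F, G
-- already does the job, ABA-freeness first forces a ∈ E and b ∈ F, and then forces
-- F ⊇ [v, b] as soon as E misses a vertex of [a, v]. Applied to the whole vertex
-- set with v just after the longest initial segment contained in a single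
-- hyperedge, this yields two hyperedges whose union is V.

open import Defs
open import Data.Nat using (ℕ; zero; suc; _+_; _≤_; _<_; z≤n; s≤s; s≤s⁻¹; _≤?_; _<?_)
open import Data.Nat.Properties
  using (_≟_; ≤-refl; ≤-trans; <-trans; ≤-<-trans; <-≤-trans; ≤-antisym; ≤∧≢⇒<; n≤1+n; n<1+n;
         m<1+n⇒m≤n; +-suc; +-identityʳ; ≰⇒>)
open import Data.Fin using (Fin; toℕ; fromℕ<; zero; suc)
import Data.Fin.Properties as Fin
open import Data.Fin.Subset using (Subset) renaming (_∈_ to _∈ₛ_; _∉_ to _∉ₛ_)
open import Data.Fin.Subset.Properties using (_∈?_)
open import Data.List.Membership.Propositional using (_∈_)
open import Data.Product using (_,_; _×_; ∃-syntax)
open import Data.Sum using (_⊎_; inj₁; inj₂)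
open import Function using (_∘_)
open import Relation.Nullary using (yes; no; contradiction)
open import Relation.Nullary.Decidable using (_×-dec_; ¬?; decidable-stable)
open import Relation.Binary.PropositionalEquality using (_≡_; _≢_; refl; sym; subst)

toℕ-onto : ∀ {n} k → k < n → ∃[ x ] (toℕ {n} x ≡ k)
toℕ-onto k k<n = fromℕ< k<n , Fin.toℕ-fromℕ< k<n

∈∉⇒≢ : ∀ {n} {E : Subset n} {x y} → x ∈ₛ E → y ∉ₛ E → x ≢ y
∈∉⇒≢ x∈E y∉E refl = y∉E x∈E

-- Positions are natural numbers; intervals are half-open, [lo, hi).
Covers : ∀ {n} → Subset n → ℕ → ℕ → Set
Covers E lo hi = ∀ x → lo ≤ toℕ x → toℕ x < hi → x ∈ₛ E

covers-or-gap : ∀ {n} (E : Subset n) lo hi →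
                Covers E lo hi ⊎ ∃[ x ] (lo ≤ toℕ x × toℕ x < hi × x ∉ₛ E)
covers-or-gap E lo hi with Fin.any? (λ x → (lo ≤? toℕ x) ×-dec (toℕ x <? hi) ×-dec ¬? (x ∈? E))
... | yes gap = inj₂ gap
... | no no-gap = inj₁ λ x lo≤x x<hi →
  decidable-stable (x ∈? E) (λ x∉E → no-gap (x , lo≤x , x<hi , x∉E))

covers-extendʳ : ∀ {n} {E : Subset n} {lo} {b} →
                 Covers E lo (toℕ b) → b ∈ₛ E → Covers E lo (suc (toℕ b))
covers-extendʳ {b = b} cov b∈E x lo≤x x<1+b with x Fin.≟ b
... | yes refl = b∈E
... | no x≢b = cov x lo≤x (Fin.≤∧≢⇒< (m<1+n⇒m≤n x<1+b) x≢b)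

covers-extendˡ : ∀ {n} {E : Subset n} {a} {hi} →
                 Covers E (suc (toℕ a)) hi → a ∈ₛ E → Covers E (toℕ a) hi
covers-extendˡ {a = a} cov a∈E x a≤x x<hi with a Fin.≟ x
... | yes refl = a∈E
... | no a≢x = cov x (Fin.≤∧≢⇒< a≤x a≢x) x<hi

covers-union : ∀ {n} {A B : Subset n} {k} →
               Covers A 0 k → Covers B k n → (x : Fin n) → x ∈ₛ A ⊎ x ∈ₛ B
covers-union {k = k} covA covB x with toℕ x <? k
... | yes x<k = inj₁ (covA x z≤n x<k)
... | no x≮k = inj₂ (covB x (m<1+n⇒m≤n (≰⇒> x≮k)) (Fin.toℕ<n x))

module _ {n} {ℋ : Hypergraph n} (aba : ABA-free ℋ) {A B : Subset n} (A∈ℋ : A ∈ ℋ) (B∈ℋ : B ∈ ℋ)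
         {x y z : Fin n} (x<y : toℕ x < toℕ y) (y<z : toℕ y < toℕ z) where

  outer-left∈ : x ∈ₛ A → z ∈ₛ A → z ∉ₛ B → y ∈ₛ B → y ∉ₛ A → x ∈ₛ B
  outer-left∈ x∈A z∈A z∉B y∈B y∉A = decidable-stable (x ∈? B) λ x∉B →
    aba (A , B , x , y , z , A∈ℋ , B∈ℋ , x<y , y<z , x∈A , x∉B , z∈A , z∉B , y∈B , y∉A)

  outer-right∈ : x ∈ₛ A → x ∉ₛ B → z ∈ₛ A → y ∈ₛ B → y ∉ₛ A → z ∈ₛ B
  outer-right∈ x∈A x∉B z∈A y∈B y∉A = decidable-stable (z ∈? B) λ z∉B →
    aba (A , B , x , y , z , A∈ℋ , B∈ℋ , x<y , y<z , x∈A , x∉B , z∈A , z∉B , y∈B , y∉A)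

  middle∈ : x ∈ₛ A → x ∉ₛ B → z ∈ₛ A → z ∉ₛ B → y ∈ₛ B → y ∈ₛ A
  middle∈ x∈A x∉B z∈A z∉B y∈B = decidable-stable (y ∈? A) λ y∉A →
    aba (A , B , x , y , z , A∈ℋ , B∈ℋ , x<y , y<z , x∈A , x∉B , z∈A , z∉B , y∈B , y∉A)

module PairCovered {m} (ℋ : Hypergraph (2 + m)) (aba : ABA-free ℋ) (pc : PairCovering ℋ) where

  Spans : ℕ → ℕ → Set
  Spans lo hi = ∃[ E ] (E ∈ ℋ × Covers E lo hi)

  another : (v : Fin (2 + m)) → ∃[ w ] (w ≢ v)
  another zero = suc zero , λ ()
  another (suc v) = zero , λ ()

  spans-point : ∀ {k} → k < 2 + m → Spans k (suc k)
  spans-point k<n with toℕ-onto _ k<n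
  ... | v , refl with another v
  ... | w , w≢v with pc v w (w≢v ∘ sym)
  ... | E , E∈ℋ , v∈E , _ = E , E∈ℋ , λ x v≤x x<1+v →
    subst (_∈ₛ E) (Fin.toℕ-injective (≤-antisym v≤x (m<1+n⇒m≤n x<1+v))) v∈E

  widen-linked : ∀ {E F : Subset (2 + m)} {u w : Fin (2 + m)} {v} → E ∈ ℋ → F ∈ ℋ →
                 Covers E v (toℕ w) → Covers F (suc (toℕ u)) (suc v) →
                 u ∈ₛ E → w ∈ₛ F → w ∉ₛ E → Spans (toℕ u) (suc v) ⊎ Spans v (suc (toℕ w))
  widen-linked {E} {F} {u} {w} {v} E∈ℋ F∈ℋ covE covF u∈E w∈F w∉E
    with covers-or-gap E (toℕ u) (suc v)
  ... | inj₁ covE′ = inj₁ (E , E∈ℋ , covE′)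
  ... | inj₂ (x , u≤x , x<1+v , x∉E) = inj₂ (F , F∈ℋ , covers-extendʳ covF′ w∈F)
    where
    x∈F : x ∈ₛ F
    x∈F = covF x (Fin.≤∧≢⇒< u≤x (∈∉⇒≢ u∈E x∉E)) x<1+v
    covF′ : Covers F v (toℕ w)
    covF′ z v≤z z<w = middle∈ aba F∈ℋ E∈ℋ x<z z<w x∈F x∉E w∈F w∉E z∈E
      where
      z∈E : z ∈ₛ E
      z∈E = covE z v≤z z<w
      x<z : toℕ x < toℕ z
      x<z = Fin.≤∧≢⇒< (≤-trans (m<1+n⇒m≤n x<1+v) v≤z) (∈∉⇒≢ z∈E x∉E ∘ sym)

  widen : ∀ {a v b} {E F : Subset (2 + m)} → a < v → v < b → b < 2 + m → E ∈ ℋ → F ∈ ℋ →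
          Covers E v b → Covers F (suc a) (suc v) → Spans a (suc v) ⊎ Spans v (suc b)
  widen {v = v} {E = E} {F = F} a<v v<b b<n E∈ℋ F∈ℋ covE covF
    with toℕ-onto _ (<-trans (<-trans a<v v<b) b<n) | toℕ-onto _ b<n
  ... | u , refl | w , refl with w ∈? E | u ∈? F
  ... | yes w∈E | _ = inj₂ (E , E∈ℋ , covers-extendʳ covE w∈E)
  ... | no _ | yes u∈F = inj₁ (F , F∈ℋ , covers-extendˡ covF u∈F)
  ... | no w∉E | no u∉F with pc u w (λ u≡w → contradiction u≡w (Fin.<⇒≢ (<-trans a<v v<b)))
  ... | G , G∈ℋ , u∈G , w∈G
    with covers-or-gap G v (suc (toℕ w)) | covers-or-gap G (toℕ u) (suc v)
  ... | inj₁ covG | _ = inj₂ (G , G∈ℋ , covG)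
  ... | inj₂ _ | inj₁ covG = inj₁ (G , G∈ℋ , covG)
  ... | inj₂ (y , v≤y , y<1+w , y∉G) | inj₂ (x , u≤x , x<1+v , x∉G) =
    widen-linked E∈ℋ F∈ℋ covE covF u∈E w∈F w∉E
    where
    y<w : toℕ y < toℕ w
    y<w = Fin.≤∧≢⇒< (m<1+n⇒m≤n y<1+w) (∈∉⇒≢ w∈G y∉G ∘ sym)
    u∈E : u ∈ₛ E
    u∈E = outer-left∈ aba G∈ℋ E∈ℋ (<-≤-trans a<v v≤y) y<w
            u∈G w∈G w∉E (covE y v≤y y<w) y∉G
    u<x : toℕ u < toℕ x
    u<x = Fin.≤∧≢⇒< u≤x (∈∉⇒≢ u∈G x∉G)
    w∈F : w ∈ₛ F
    w∈F = outer-right∈ aba G∈ℋ F∈ℋ u<x (≤-<-trans (m<1+n⇒m≤n x<1+v) v<b)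
            u∈G u∉F w∈G (covF x u<x x<1+v) x∉G

  spans-left-or-right : ∀ d a → a + d < 2 + m → ∀ v → a ≤ v → v ≤ a + d →
                        Spans a (suc v) ⊎ Spans v (suc (a + d))
  spans-left-or-right d a a+d<n v a≤v v≤a+d with v ≟ a
  ... | yes refl = inj₁ (spans-point (≤-<-trans v≤a+d a+d<n))
  spans-left-or-right zero a _ v a≤v v≤a+0 | no v≢a rewrite +-identityʳ a =
    contradiction (≤-antisym v≤a+0 a≤v) v≢a
  spans-left-or-right (suc d) a a+d<n v a≤v v≤a+d | no v≢a rewrite +-suc a d
    with v ≟ suc (a + d)
  ... | yes refl = inj₂ (spans-point a+d<n)
  ... | no v≢b
    with spans-left-or-right d a (≤-trans (n≤1+n _) a+d<n) v a≤v (m<1+n⇒m≤n (≤∧≢⇒< v≤a+d v≢b))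
       | spans-left-or-right d (suc a) a+d<n v (≤∧≢⇒< a≤v (v≢a ∘ sym)) v≤a+d
  ... | inj₁ left | _ = inj₁ left
  ... | inj₂ _ | inj₂ right = inj₂ right
  ... | inj₂ (E , E∈ℋ , covE) | inj₁ (F , F∈ℋ , covF) =
    widen (≤∧≢⇒< a≤v (v≢a ∘ sym)) (≤∧≢⇒< v≤a+d v≢b) a+d<n E∈ℋ F∈ℋ covE covF

  initial-segment-or-two : ∀ k → k < 2 + m → Spans 0 (suc k) ⊎ CoveredByTwo ℋ
  initial-segment-or-two zero 0<n = inj₁ (spans-point 0<n)
  initial-segment-or-two (suc k) k+1<n with initial-segment-or-two k (<-trans (n<1+n k) k+1<n)
  ... | inj₂ two = inj₂ two
  ... | inj₁ (A , A∈ℋ , covA) with spans-left-or-right (suc m) 0 ≤-refl (suc k) z≤n (s≤s⁻¹ k+1<n)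
  ... | inj₁ longer = inj₁ longer
  ... | inj₂ (B , B∈ℋ , covB) = inj₂ (A , B , A∈ℋ , B∈ℋ , covers-union covA covB)

  covered-by-two : CoveredByTwo ℋ
  covered-by-two with initial-segment-or-two (suc m) ≤-refl
  ... | inj₁ (A , A∈ℋ , covA) = A , A , A∈ℋ , A∈ℋ , λ x → inj₁ (covA x z≤n (Fin.toℕ<n x))
  ... | inj₂ two = two

mainTheorem2 : (n : ℕ) → 2 ≤ n → (ℋ : Hypergraph n) →
    ABA-free ℋ → PairCovering ℋ → CoveredByTwo ℋ
mainTheorem2 (suc (suc m)) (s≤s (s≤s z≤n)) ℋ aba pc = PairCovered.covered-by-two ℋ aba pc
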